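{- Let $\mathbb{M}$ be a simple matroid of rank $r+1\ge 2$ on $E=\{0,\dots,n\}$. Then \[ \alpha\cup\Delta_\mathbb{M}=\Delta_{\mathrm{Trunc}_{r-1}(\mathbb{M})} \] in $A^*(X(\Delta_{\mathbb{U}_n}))$.
   Context: $N=\mathbb{Z}^E/\langle e_0+\cdots+e_n\rangle\cong\mathbb{Z}^n$ with coordinates in which $e_1,\dots,e_n$ are the standard basis and $e_0=(-1,\dots,-1)$; for $I\subseteq E$, $e_I=\sum_{i\in I}e_i$ (so $e_E=0$). For a loopless matroid $\mathbb{M}'$ on $E$ of rank $d+1$, its matroid fan $\Delta_{\mathbb{M}'}$ is the fan in $N_\mathbb{R}$ with cones $\sigma_\mathcal{F}=\mathrm{cone}(e_{F_1},\dots,e_{F_j})$ for chains $\mathcal{F}=\{\emptyset\subsetneq F_1\subsetneq\cdots\subsetneq F_j\subsetneq E\}$ of flats of $\mathbb{M}'$; it is pure of dimension $d$. $\mathbb{U}_n$ is the uniform matroid of rank $n+1$ on $E$ (all subsets are flats); $\Delta_{\mathbb{U}_n}$ is complete and unimodular and contains every $\Delta_{\mathbb{M}'}$ as a subfan; $X(\Delta_{\mathbb{U}_n})$ is the associated smooth complete toric variety. The truncation $\mathrm{Trunc}_{k}(\mathbb{M})$ ($k\le r$) is the matroid on $E$ with rank function $\min\{r(I),k+1\}$. By Fulton–Sturmfels, $A^c(X)$ is the group of Minkowski weights of codimension $c$: functions $w$ on codimension-$c$ cones of $\Delta_{\mathbb{U}_n}$ with $\sum_{\sigma\supset\tau}w(\sigma)v_{\sigma/\tau}=0$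 in $N/N_\tau$ for each codimension-$(c+1)$ cone $\tau$ ($N_\tau$ the sublattice generated by $\tau\cap N$, $v_{\sigma/\tau}$ the primitive generator of the image of $\sigma$ in $N/N_\tau$). $\Delta_{\mathbb{M}'}$ denotes the Minkowski weight of codimension $n-d$ equal to $1$ on $d$-dimensional cones of $\Delta_{\mathbb{M}'}$ and $0$ elsewhere. $\alpha=\min\{0,x_1,\dots,x_n\}$ is a piecewise linear function linear on each cone of $\Delta_{\mathbb{U}_n}$ (a $T$-Cartier divisor, corresponding to the pullback of $\mathcal{O}(1)$ along the blowdown $X(\Delta_{\mathbb{U}_n})\to\mathbb{P}^n$); for a Minkowski weight $w$ of codimension $k$, $\alpha\cup w$ is the Minkowski weight of codimension $k+1$ given on a codimension-$(k+1)$ cone $\tau$ by \[ (\alpha\cup w)(\tau)=-\sum_{\sigma\supset\tau}\alpha_\sigma(u_{\sigma/\tau})w(\sigma)+\alpha_\tau\Big(\sum_{\sigma\supset\tau}w(\sigma)u_{\sigma/\tau}\Big), \] the sums over codimension-$k$ cones $\sigma\supset\tau$, where $u_{\sigma/\tau}\in N_\sigma$ is any lift of $v_{\sigma/\tau}$ and $\alpha_\sigma,\alpha_\tau$ are the linear functions agreeing with $\alpha$ on $\sigma,\tau$. -}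

module Defs where

open import Data.Nat as ℕ using (ℕ; zero; suc; _≤_; _<_)
import Data.Nat.Properties as ℕP
open import Data.Integer as ℤ using (ℤ; 0ℤ; 1ℤ; _⊓_)
open import Data.Fin using (Fin; zero; suc)
import Data.Fin.Properties as FinP
open import Data.Fin.Subset using (Subset; _∈_; _∉_; _⊆_; _⊂_; _∪_; _∩_; ⁅_⁆; ∣_∣; ⊤; Nonempty; inside; outside)
open import Data.Fin.Subset.Properties using (_∈?_; _⊂?_; nonempty?)
open import Data.Vec using (Vec; []; _∷_)
open import Data.List using (List; []; _∷_; _++_; map; foldr; allFin)
open import Data.List.Relation.Unary.All using (All; all?)
open import Data.List.Relation.Unary.AllPairs using (AllPairs; allPairs?)
open import Data.Product using (_×_)
open import Data.Sum using (_⊎_)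
open import Data.Bool using (if_then_else_)
open import Relation.Nullary using (Dec; ¬?; _×-dec_; _⊎-dec_; _→-dec_)
open import Relation.Nullary.Decidable using (⌊_⌋)
open import Relation.Binary.PropositionalEquality using (_≡_; _≢_)

record Matroid (m : ℕ) : Set where
  field
    rk        : Subset m → ℕ
    rk-bound  : ∀ X → rk X ≤ ∣ X ∣
    rk-mono   : ∀ X Y → X ⊆ Y → rk X ≤ rk Y
    rk-submod : ∀ X Y → rk (X ∪ Y) ℕ.+ rk (X ∩ Y) ≤ rk X ℕ.+ rk Y
open Matroid public

Simple : ∀ {m} → Matroid m → Set
Simple M = (∀ i → rk M ⁅ i ⁆ ≡ 1)
         × (∀ i j → i ≢ j → rk M (⁅ i ⁆ ∪ ⁅ j ⁆) ≡ 2)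

Flat : ∀ {m} → (Subset m → ℕ) → Subset m → Set
Flat ρ F = ∀ e → e ∉ F → ρ F < ρ (F ∪ ⁅ e ⁆)

flat? : ∀ {m} (ρ : Subset m → ℕ) (F : Subset m) → Dec (Flat ρ F)
flat? ρ F = FinP.all? (λ e → ¬? (e ∈? F) →-dec (ρ F ℕP.<? ρ (F ∪ ⁅ e ⁆)))

truncRk : ∀ {m} → Matroid m → ℕ → Subset m → ℕ
truncRk M k X = rk M X ℕ.⊓ suc k

-- The fan Δ_{U_n}: a cone is given by a chain of proper nonempty subsets
-- of E = Fin (suc n); we represent it by a list of its generating sets
-- (in any order), required pairwise strictly comparable.

Proper : ∀ {m} → Subset m → Set
Proper X = Nonempty X × X ⊂ ⊤

Comparable : ∀ {m} → Subset m → Subset m → Set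
Comparable X Y = X ⊂ Y ⊎ Y ⊂ X

IsCone : ∀ {m} → List (Subset m) → Set
IsCone L = All Proper L × AllPairs Comparable L

isCone? : ∀ {m} (L : List (Subset m)) → Dec (IsCone L)
isCone? L = all? (λ X → nonempty? X ×-dec (X ⊂? ⊤)) L
            ×-dec allPairs? (λ X Y → (X ⊂? Y) ⊎-dec (Y ⊂? X)) L

allSubsets : ∀ m → List (Subset m)
allSubsets zero    = [] ∷ []
allSubsets (suc m) = map (outside ∷_) (allSubsets m) ++ map (inside ∷_) (allSubsets m)

-- The lattice N = ℤ^E / ⟨e_0+…+e_n⟩ ≅ ℤ^n, vectors as  Fin n → ℤ

Vecℤ : ℕ → Set
Vecℤ n = Fin n → ℤ

sumℤ : List ℤ → ℤ
sumℤ = foldr ℤ._+_ 0ℤ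

ind : ∀ {m} → Fin m → Subset m → ℤ
ind x I = if ⌊ x ∈? I ⌋ then 1ℤ else 0ℤ

-- e_I, with e_0 = (-1,…,-1) and e_i (i ≥ 1) the standard basis vectors
eVec : ∀ {n} → Subset (suc n) → Vecℤ n
eVec I j = ind (suc j) I ℤ.- ind zero I

⟪_,_⟫ : ∀ {n} → Vecℤ n → Vecℤ n → ℤ
⟪_,_⟫ {n} a x = sumℤ (map (λ j → a j ℤ.* x j) (allFin n))

α : ∀ {n} → Vecℤ n → ℤ
α {n} x = foldr _⊓_ 0ℤ (map x (allFin n))

-- a linear functional agreeing with α on the cone τ
-- (equivalently on its generators e_F, F ∈ τ, since α is linear on τ)
AgreesWithαOn : ∀ {n} → Vecℤ n → List (Subset (suc n)) → Set
AgreesWithαOn a τ = All (λ F → ⟪ a , eVec F ⟫ ≡ α (eVec F)) τ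

Weight : ℕ → Set
Weight n = List (Subset (suc n)) → ℤ

-- the weight Δ_{M'} (for a rank function ρ): 1 on cones all of whose
-- generating sets are flats, 0 otherwise (used on cones of top dimension)
ΔFan : ∀ {n} → (Subset (suc n) → ℕ) → Weight n
ΔFan ρ σ = if ⌊ all? (flat? ρ) σ ⌋ then 1ℤ else 0ℤ

-- coefficient of σ = S ∷ τ in the sums over cones σ ⊃ τ of one dimension more
-- (0 if S ∷ τ is not a cone of Δ_{U_n})
coneCoeff : ∀ {n} → Weight n → List (Subset (suc n)) → Subset (suc n) → ℤ
coneCoeff w τ S = if ⌊ isCone? (S ∷ τ) ⌋ then w (S ∷ τ) else 0ℤ

-- α ∪ w evaluated at τ, with α_τ given by the functional ατ and lift
-- u_{σ/τ} = e_S for σ = S ∷ τ (so α_σ(u_{σ/τ}) = α(e_S))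
cupα : ∀ {n} → Vecℤ n → Weight n → List (Subset (suc n)) → ℤ
cupα {n} ατ w τ =
  ℤ.- sumℤ (map (λ S → α (eVec S) ℤ.* coneCoeff w τ S) (allSubsets (suc n)))
  ℤ.+ ⟪ ατ , (λ j → sumℤ (map (λ S → coneCoeff w τ S ℤ.* eVec S j) (allSubsets (suc n)))) ⟫

-- If some member of τ is not a flat of M, no cone σ ⊃ τ carries weight and both sides vanish.
-- Otherwise padding τ with ∅ and E gives a chain of flats whose r + 1 ranks are distinct values
-- in {0, …, r + 1}, so exactly one rank k ∈ {1, …, r} is missing; let G ⊂ H be the members of
-- ranks k − 1 and k + 1. The cones τ ∪ {S} of Δ_M are those with S a flat of rank k between G
-- and H, and these flats partition H ∖ G, so Σ e_S = (N − 1) e_G + e_H. As α(e_S) = −[0 ∈ S]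
-- for S ≠ E and α_τ agrees with α at e_G and e_H, (α ∪ Δ_M)(τ) = [0 ∈ H] + α(e_H) = [H = E],
-- which is 1 exactly when no flat of τ has rank r, i.e. when τ is a cone of Δ_{Trunc_{r-1} M}.
module Submission where

open import Defs
open import Data.Nat as ℕ using (ℕ; zero; suc; _≤_; _<_; _∸_; z≤n; s≤s)
import Data.Nat.Properties as ℕP
open import Data.Integer as ℤ using (ℤ; 0ℤ; 1ℤ; -1ℤ; _+_; _-_; _*_; -_; +≤+)
import Data.Integer.Properties as ℤP
open import Data.Integer.Tactic.RingSolver using (solve-∀)
open import Data.Empty using (⊥-elim)
open import Data.Fin using (Fin; zero; suc)
open import Data.Fin.Properties using (any?)
open import Data.Fin.Subset using (Subset; _∈_; _∉_; _⊆_; _⊂_; _∪_; _∩_; ⁅_⁆; ⊤; ⊥; Nonempty; inside; outside)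
open import Data.Fin.Subset.Properties
  using ( _∈?_; ∈⊤; ∉⊥; ⊆⊤; ⊥⊆; ∣⊥∣≡0; ∣⁅x⁆∣≡1; x∈⁅x⁆; x∈⁅y⁆⇒x≡y
        ; p⊆p∪q; q⊆p∪q; x∈p∪q⁻; x∈p∩q⁺; ⊆-antisym; ⊆-trans)
open import Data.Vec using ([]; _∷_; tail)
open import Data.List using (List; []; _∷_; _++_; map; foldr; filter; length; upTo; allFin)
open import Data.List.Properties using (length-++; length-upTo; length-map; map-++; map-∘)
open import Data.List.Relation.Unary.All as All using (All; []; _∷_; all?)
import Data.List.Relation.Unary.All.Properties as AllP
open import Data.List.Relation.Unary.AllPairs using (AllPairs; []; _∷_)
open import Data.List.Relation.Unary.Any using (here; there)
open import Data.List.Relation.Unary.Unique.Propositional using (Unique)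
open import Data.List.Relation.Unary.Unique.Propositional.Properties using (upTo⁺)
import Data.List.Membership.Propositional as List
open import Data.List.Membership.Propositional.Properties
  using (∈-∃++; ∈-++⁻; ∈-++⁺ˡ; ∈-++⁺ʳ; ∈-upTo⁺; ∈-upTo⁻; ∈-map⁺; ∈-map⁻; ∈-allFin; ∈-filter⁺; ∈-filter⁻)
import Data.List.Membership.DecPropositional ℕP._≟_ as ℕList
open import Data.Product using (_×_; _,_; proj₁; proj₂; ∃)
open import Data.Sum using (_⊎_; inj₁; inj₂; swap)
open import Function using (id; _∘_)
open import Relation.Nullary using (Dec; yes; no; ¬_; ¬?; _×-dec_)
open import Relation.Nullary.Decidable using (decidable-stable)
open import Relation.Nullary.Negation using (contradiction)
open import Relation.Binary.Definitions using (Tri; tri<; tri≈; tri>)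
open import Relation.Binary.PropositionalEquality
  using (_≡_; _≢_; refl; sym; trans; cong; cong₂; subst; subst₂; module ≡-Reasoning)

length-≤-of-unique⊆ : ∀ {A : Set} {xs ys : List A} → Unique xs → All (List._∈ ys) xs → length xs ≤ length ys
length-≤-of-unique⊆ {xs = []} _ _ = z≤n
length-≤-of-unique⊆ {xs = x ∷ xs} (x∉xs ∷ uxs) (x∈ys ∷ xs⊆ys) with ∈-∃++ x∈ys
... | as , bs , refl = subst (suc (length xs) ≤_) (sym length-split)
  (s≤s (length-≤-of-unique⊆ uxs (All.zipWith (λ (x≢z , z∈) → remove x≢z z∈) (x∉xs , xs⊆ys))))
  where
  length-split : length (as ++ x ∷ bs) ≡ suc (length (as ++ bs))
  length-split = trans (length-++ as) (trans (ℕP.+-suc (length as) (length bs)) (cong suc (sym (length-++ as))))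
  remove : ∀ {z} → x ≢ z → z List.∈ as ++ x ∷ bs → z List.∈ as ++ bs
  remove x≢z z∈ with ∈-++⁻ as z∈
  ... | inj₁ z∈as = ∈-++⁺ˡ z∈as
  ... | inj₂ (here z≡x) = ⊥-elim (x≢z (sym z≡x))
  ... | inj₂ (there z∈bs) = ∈-++⁺ʳ as z∈bs

missing-value : ∀ m (L : List ℕ) → Unique L → All (_< suc m) L → length L ≡ m →
  ∃ λ k → k < suc m × k List.∉ L × (∀ {j} → j < suc m → j List.∉ L → j ≡ k)
missing-value m L uL L<m lenL with all? (ℕList._∈? L) (upTo (suc m))
... | yes all∈ = ⊥-elim (ℕP.<-irrefl (sym lenL)
  (subst (_≤ length L) (length-upTo (suc m)) (length-≤-of-unique⊆ (upTo⁺ (suc m)) all∈)))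
... | no ¬all∈ with List.find (AllP.¬All⇒Any¬ (ℕList._∈? L) (upTo (suc m)) ¬all∈)
... | k , k∈ , k∉L = k , ∈-upTo⁻ k∈ , k∉L , only
  where
  only : ∀ {j} → j < suc m → j List.∉ L → j ≡ k
  only {j} j<m j∉L with j ℕP.≟ k
  ... | yes j≡k = j≡k
  ... | no j≢k = ⊥-elim (ℕP.<-irrefl lenL (ℕP.≤-pred (subst (suc (suc (length L)) ≤_) (length-upTo (suc m))
    (length-≤-of-unique⊆ ((j≢k ∷ AllP.¬Any⇒All¬ L j∉L) ∷ AllP.¬Any⇒All¬ L k∉L ∷ uL)
                         (∈-upTo⁺ j<m ∷ k∈ ∷ All.map ∈-upTo⁺ L<m)))))

module _ {A : Set} where

  sumℤ-cong : (L : List A) {f g : A → ℤ} → (∀ x → f x ≡ g x) → sumℤ (map f L) ≡ sumℤ (map g L)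
  sumℤ-cong []      f≗g = refl
  sumℤ-cong (x ∷ L) f≗g = cong₂ _+_ (f≗g x) (sumℤ-cong L f≗g)

  sumℤ-zero : (L : List A) {f : A → ℤ} → (∀ x → f x ≡ 0ℤ) → sumℤ (map f L) ≡ 0ℤ
  sumℤ-zero []      f≗0 = refl
  sumℤ-zero (x ∷ L) f≗0 = cong₂ _+_ (f≗0 x) (sumℤ-zero L f≗0)

  sumℤ-+ : (L : List A) (f g : A → ℤ) → sumℤ (map (λ x → f x + g x) L) ≡ sumℤ (map f L) + sumℤ (map g L)
  sumℤ-+ []      f g = refl
  sumℤ-+ (x ∷ L) f g = trans (cong (f x + g x +_) (sumℤ-+ L f g)) (interchange (f x) (g x) _ _)
    where
    interchange : ∀ a b c d → a + b + (c + d) ≡ a + c + (b + d)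
    interchange = solve-∀

  sumℤ-neg : (L : List A) (f : A → ℤ) → sumℤ (map (λ x → - f x) L) ≡ - sumℤ (map f L)
  sumℤ-neg []      f = refl
  sumℤ-neg (x ∷ L) f = trans (cong (- f x +_) (sumℤ-neg L f)) (sym (ℤP.neg-distrib-+ (f x) _))

  sumℤ-- : (L : List A) (f g : A → ℤ) → sumℤ (map (λ x → f x - g x) L) ≡ sumℤ (map f L) - sumℤ (map g L)
  sumℤ-- L f g = trans (sumℤ-+ L f (λ x → - g x)) (cong (sumℤ (map f L) +_) (sumℤ-neg L g))

  sumℤ-*ˡ : (L : List A) (c : ℤ) (f : A → ℤ) → sumℤ (map (λ x → c * f x) L) ≡ c * sumℤ (map f L)
  sumℤ-*ˡ []      c f = sym (ℤP.*-zeroʳ c)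
  sumℤ-*ˡ (x ∷ L) c f = trans (cong (c * f x +_) (sumℤ-*ˡ L c f)) (sym (ℤP.*-distribˡ-+ c (f x) _))

sumℤ-++ : (xs ys : List ℤ) → sumℤ (xs ++ ys) ≡ sumℤ xs + sumℤ ys
sumℤ-++ []       ys = sym (ℤP.+-identityˡ _)
sumℤ-++ (x ∷ xs) ys = trans (cong (x +_) (sumℤ-++ xs ys)) (sym (ℤP.+-assoc x _ _))

sumℤ-allSubsets-single : ∀ m (f : Subset m → ℤ) S₀ → (∀ S → S ≢ S₀ → f S ≡ 0ℤ) →
  sumℤ (map f (allSubsets m)) ≡ f S₀
sumℤ-allSubsets-single zero    f []       f≡0 = ℤP.+-identityʳ _
sumℤ-allSubsets-single (suc m) f (b ∷ S₀) f≡0 = begin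
    sumℤ (map f (map (outside ∷_) A ++ map (inside ∷_) A))
  ≡⟨ cong sumℤ (map-++ f (map (outside ∷_) A) _) ⟩
    sumℤ (map f (map (outside ∷_) A) ++ map f (map (inside ∷_) A))
  ≡⟨ sumℤ-++ (map f (map (outside ∷_) A)) _ ⟩
    sumℤ (map f (map (outside ∷_) A)) + sumℤ (map f (map (inside ∷_) A))
  ≡⟨ cong₂ _+_ (cong sumℤ (sym (map-∘ A))) (cong sumℤ (sym (map-∘ A))) ⟩
    sumℤ (map (λ S → f (outside ∷ S)) A) + sumℤ (map (λ S → f (inside ∷ S)) A)
  ≡⟨ halves b f≡0 ⟩
    f (b ∷ S₀) ∎
  where
  open ≡-Reasoning
  A = allSubsets m
  Vanishes : Subset (suc m) → Set
  Vanishes S₁ = ∀ S → S ≢ S₁ → f S ≡ 0ℤ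
  rest : ∀ c → Vanishes (c ∷ S₀) → sumℤ (map (λ S → f (c ∷ S)) A) ≡ f (c ∷ S₀)
  rest c f≡0 = sumℤ-allSubsets-single m (λ S → f (c ∷ S)) S₀ (λ S S≢S₀ → f≡0 _ (λ eq → S≢S₀ (cong tail eq)))
  halves : ∀ b → Vanishes (b ∷ S₀) →
    sumℤ (map (λ S → f (outside ∷ S)) A) + sumℤ (map (λ S → f (inside ∷ S)) A) ≡ f (b ∷ S₀)
  halves outside f≡0 = trans (cong₂ _+_ (rest outside f≡0) (sumℤ-zero A (λ S → f≡0 _ (λ ())))) (ℤP.+-identityʳ _)
  halves inside  f≡0 = trans (cong₂ _+_ (sumℤ-zero A (λ S → f≡0 _ (λ ()))) (rest inside f≡0)) (ℤP.+-identityˡ _)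

⟪⟫-cong : ∀ {n} (a : Vecℤ n) {x y : Vecℤ n} → (∀ j → x j ≡ y j) → ⟪ a , x ⟫ ≡ ⟪ a , y ⟫
⟪⟫-cong {n} a x≗y = sumℤ-cong (allFin n) (λ j → cong (a j *_) (x≗y j))

⟪⟫-zeroʳ : ∀ {n} (a : Vecℤ n) {x : Vecℤ n} → (∀ j → x j ≡ 0ℤ) → ⟪ a , x ⟫ ≡ 0ℤ
⟪⟫-zeroʳ {n} a x≗0 = sumℤ-zero (allFin n) (λ j → trans (cong (a j *_) (x≗0 j)) (ℤP.*-zeroʳ (a j)))

⟪⟫-linear : ∀ {n} (a x y : Vecℤ n) (c : ℤ) → ⟪ a , (λ j → c * x j + y j) ⟫ ≡ c * ⟪ a , x ⟫ + ⟪ a , y ⟫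
⟪⟫-linear {n} a x y c = begin
    sumℤ (map (λ j → a j * (c * x j + y j)) L)
  ≡⟨ sumℤ-cong L (λ j → distrib (a j) c (x j) (y j)) ⟩
    sumℤ (map (λ j → c * (a j * x j) + a j * y j) L)
  ≡⟨ sumℤ-+ L (λ j → c * (a j * x j)) (λ j → a j * y j) ⟩
    sumℤ (map (λ j → c * (a j * x j)) L) + ⟪ a , y ⟫
  ≡⟨ cong (_+ ⟪ a , y ⟫) (sumℤ-*ˡ L c (λ j → a j * x j)) ⟩
    c * ⟪ a , x ⟫ + ⟪ a , y ⟫ ∎
  where
  open ≡-Reasoning
  L = allFin n
  distrib : ∀ a c x y → a * (c * x + y) ≡ c * (a * x) + a * y
  distrib = solve-∀

ind-∈ : ∀ {m} {x : Fin m} {S} → x ∈ S → ind x S ≡ 1ℤ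
ind-∈ {x = x} {S} x∈S with x ∈? S
... | yes _   = refl
... | no x∉S = contradiction x∈S x∉S

ind-∉ : ∀ {m} {x : Fin m} {S} → x ∉ S → ind x S ≡ 0ℤ
ind-∉ {x = x} {S} x∉S with x ∈? S
... | yes x∈S = contradiction x∈S x∉S
... | no _    = refl

0≤ind : ∀ {m} (x : Fin m) S → 0ℤ ℤ.≤ ind x S
0≤ind x S with x ∈? S
... | yes _ = +≤+ ℕ.z≤n
... | no _  = +≤+ ℕ.z≤n

foldr-⊓-≡ : ∀ {v b} (L : List ℤ) → v ℤ.≤ b → All (v ℤ.≤_) L → v ≡ b ⊎ v List.∈ L → foldr ℤ._⊓_ b L ≡ v
foldr-⊓-≡ []      _   _          (inj₁ refl)        = refl
foldr-⊓-≡ (y ∷ L) v≤b (v≤y ∷ v≤L) (inj₂ (here refl)) = ℤP.i≤j⇒i⊓j≡i (glb L v≤L)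
  where
  glb : ∀ L → All (y ℤ.≤_) L → y ℤ.≤ foldr ℤ._⊓_ _ L
  glb []      _            = v≤b
  glb (z ∷ L) (y≤z ∷ y≤L) = ℤP.⊓-glb y≤z (glb L y≤L)
foldr-⊓-≡ (y ∷ L) v≤b (v≤y ∷ v≤L) (inj₁ v≡b)        =
  trans (cong (y ℤ.⊓_) (foldr-⊓-≡ L v≤b v≤L (inj₁ v≡b))) (ℤP.i≥j⇒i⊓j≡j v≤y)
foldr-⊓-≡ (y ∷ L) v≤b (v≤y ∷ v≤L) (inj₂ (there v∈L)) =
  trans (cong (y ℤ.⊓_) (foldr-⊓-≡ L v≤b v≤L (inj₂ v∈L))) (ℤP.i≥j⇒i⊓j≡j v≤y)

α-nonneg : ∀ {n} (x : Vecℤ n) → (∀ j → 0ℤ ℤ.≤ x j) → α x ≡ 0ℤ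
α-nonneg {n} x 0≤x = foldr-⊓-≡ _ ℤP.≤-refl (AllP.map⁺ {xs = allFin n} (All.tabulate (λ {j} _ → 0≤x j))) (inj₁ refl)

α-attains-−1 : ∀ {n} (x : Vecℤ n) j → (∀ i → -1ℤ ℤ.≤ x i) → x j ≡ -1ℤ → α x ≡ -1ℤ
α-attains-−1 {n} x j -1≤x xj≡-1 = foldr-⊓-≡ _ (ℤ.-≤+) (AllP.map⁺ {xs = allFin n} (All.tabulate (λ {i} _ → -1≤x i)))
  (inj₂ (subst (List._∈ map x (allFin n)) xj≡-1 (∈-map⁺ x (∈-allFin j))))

-- The coordinates of e_S are [i ∈ S] − [0 ∈ S]; an element outside S makes their minimum −[0 ∈ S].
α-eVec : ∀ {n} {S : Subset (suc n)} {e} → e ∉ S → α (eVec S) ≡ - ind zero S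
α-eVec {n} {S} {e} e∉S = by-cases (zero ∈? S) e e∉S
  where
  coord : ∀ {c} → ind zero S ≡ c → ∀ j → eVec S j ≡ ind (suc j) S - c
  coord ind≡c j = cong (λ c → ind (suc j) S - c) ind≡c
  by-cases : Dec (zero ∈ S) → ∀ e → e ∉ S → α (eVec S) ≡ - ind zero S
  by-cases (no 0∉S) _ _ = trans
    (α-nonneg (eVec S) (λ j → subst (0ℤ ℤ.≤_) (trans (sym (ℤP.+-identityʳ _)) (sym (coord (ind-∉ 0∉S) j))) (0≤ind (suc j) S)))
    (cong -_ (sym (ind-∉ 0∉S)))
  by-cases (yes 0∈S) zero    0∉S = contradiction 0∈S 0∉S
  by-cases (yes 0∈S) (suc j) e∉S = trans
    (α-attains-−1 (eVec S) j
      (λ i → subst (-1ℤ ℤ.≤_) (sym (coord (ind-∈ 0∈S) i))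
        (subst (ℤ._≤ ind (suc i) S - 1ℤ) (ℤP.+-identityˡ -1ℤ) (ℤP.+-monoˡ-≤ -1ℤ (0≤ind (suc i) S))))
      (trans (coord (ind-∈ 0∈S) j) (cong (_- 1ℤ) (ind-∉ e∉S))))
    (cong -_ (sym (ind-∈ 0∈S)))

eVec-⊤ : ∀ {n} (j : Fin n) → eVec (⊤ {suc n}) j ≡ 0ℤ
eVec-⊤ {n} j = cong₂ _-_ (ind-∈ {x = suc j} {S = ⊤} ∈⊤) (ind-∈ {x = zero {n}} {S = ⊤} ∈⊤)

eVec-⊥ : ∀ {n} (j : Fin n) → eVec (⊥ {suc n}) j ≡ 0ℤ
eVec-⊥ {n} j = cong₂ _-_ (ind-∉ {x = suc j} {S = ⊥} ∉⊥) (ind-∉ {x = zero {n}} {S = ⊥} ∉⊥)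

α-eVec-⊤ : ∀ {n} → α (eVec (⊤ {suc n})) ≡ 0ℤ
α-eVec-⊤ {n} = α-nonneg (eVec (⊤ {suc n})) (λ j → ℤP.≤-reflexive (sym (eVec-⊤ j)))

α-eVec-⊥ : ∀ {n} → α (eVec (⊥ {suc n})) ≡ 0ℤ
α-eVec-⊥ {n} = α-nonneg (eVec (⊥ {suc n})) (λ j → ℤP.≤-reflexive (sym (eVec-⊥ j)))

∪-least : ∀ {m} {A B C : Subset m} → A ⊆ C → B ⊆ C → A ∪ B ⊆ C
∪-least {A = A} {B} A⊆C B⊆C x∈A∪B with x∈p∪q⁻ A B x∈A∪B
... | inj₁ x∈A = A⊆C x∈A
... | inj₂ x∈B = B⊆C x∈B

⁅⁆⊆ : ∀ {m} {x : Fin m} {C} → x ∈ C → ⁅ x ⁆ ⊆ C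
⁅⁆⊆ {x = x} x∈C y∈⁅x⁆ = subst (_∈ _) (sym (x∈⁅y⁆⇒x≡y x y∈⁅x⁆)) x∈C

allPairs-∈ : ∀ {A : Set} {R : A → A → Set} {xs : List A} {x y} →
  AllPairs R xs → x List.∈ xs → y List.∈ xs → x ≡ y ⊎ R x y ⊎ R y x
allPairs-∈ (_ ∷ _)       (here refl) (here refl) = inj₁ refl
allPairs-∈ (Rx ∷ _)      (here refl) (there y∈)  = inj₂ (inj₁ (All.lookup Rx y∈))
allPairs-∈ (Ry ∷ _)      (there x∈)  (here refl) = inj₂ (inj₂ (All.lookup Ry x∈))
allPairs-∈ (_ ∷ Rxs)     (there x∈)  (there y∈)  = allPairs-∈ Rxs x∈ y∈

module _ {m : ℕ} (M : Matroid m) where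

  private
    ρ : Subset m → ℕ
    ρ = rk M

  rk-⊆ : ∀ {X Y} → X ⊆ Y → ρ X ≤ ρ Y
  rk-⊆ = rk-mono M _ _

  rk-⊥ : ρ ⊥ ≡ 0
  rk-⊥ = ℕP.n≤0⇒n≡0 (subst (ρ ⊥ ≤_) (∣⊥∣≡0 m) (rk-bound M ⊥))

  rk-∪-⁅⁆ : ∀ X e → ρ (X ∪ ⁅ e ⁆) ≤ suc (ρ X)
  rk-∪-⁅⁆ X e = begin
    ρ (X ∪ ⁅ e ⁆)                    ≤⟨ ℕP.m≤m+n _ _ ⟩
    ρ (X ∪ ⁅ e ⁆) ℕ.+ ρ (X ∩ ⁅ e ⁆)  ≤⟨ rk-submod M X ⁅ e ⁆ ⟩
    ρ X ℕ.+ ρ ⁅ e ⁆                   ≤⟨ ℕP.+-monoʳ-≤ (ρ X) (subst (ρ ⁅ e ⁆ ≤_) (∣⁅x⁆∣≡1 e) (rk-bound M ⁅ e ⁆)) ⟩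
    ρ X ℕ.+ 1                         ≡⟨ ℕP.+-comm (ρ X) 1 ⟩
    suc (ρ X)                         ∎
    where open ℕP.≤-Reasoning

  flat-rk-< : ∀ {A B} → Flat ρ A → A ⊂ B → ρ A < ρ B
  flat-rk-< flatA (A⊆B , x , x∈B , x∉A) = ℕP.<-≤-trans (flatA x x∉A) (rk-⊆ (∪-least A⊆B (⁅⁆⊆ x∈B)))

  rk-<⇒⊂ : ∀ {A B} → A ⊆ B → ρ A < ρ B → A ⊂ B
  rk-<⇒⊂ {A} {B} A⊆B ρA<ρB with any? (λ x → (x ∈? B) ×-dec ¬? (x ∈? A))
  ... | yes x∈B∖A = A⊆B , x∈B∖A
  ... | no ∄x∈B∖A = contradiction (rk-⊆ B⊆A) (ℕP.<⇒≱ ρA<ρB)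
    where
    B⊆A : B ⊆ A
    B⊆A {x} x∈B = decidable-stable (x ∈? A) (λ x∉A → ∄x∈B∖A (x , x∈B , x∉A))

  loopless⇒flat-⊥ : (∀ i → ρ ⁅ i ⁆ ≡ 1) → Flat ρ ⊥
  loopless⇒flat-⊥ loopless e _ = subst (_< ρ (⊥ ∪ ⁅ e ⁆)) (sym rk-⊥)
    (subst (_≤ ρ (⊥ ∪ ⁅ e ⁆)) (loopless e) (rk-⊆ (q⊆p∪q ⊥ ⁅ e ⁆)))

  flat-⊤ : Flat ρ ⊤
  flat-⊤ e e∉⊤ = contradiction ∈⊤ e∉⊤

  flat-full-rank : ∀ {F} → Flat ρ F → ρ F ≡ ρ ⊤ → F ≡ ⊤
  flat-full-rank {F} flatF ρF≡ρ⊤ = ⊆-antisym ⊆⊤ ⊤⊆F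
    where
    ⊤⊆F : ⊤ ⊆ F
    ⊤⊆F {x} _ = decidable-stable (x ∈? F) λ x∉F →
      ℕP.<⇒≱ (flatF x x∉F) (subst (ρ (F ∪ ⁅ x ⁆) ≤_) (sym ρF≡ρ⊤) (rk-⊆ ⊆⊤))

  Redundant : Subset m → Fin m → Set
  Redundant X e = ρ (X ∪ ⁅ e ⁆) ≡ ρ X

  redundant-upward : ∀ {X Z e} → X ⊆ Z → Redundant X e → Redundant Z e
  redundant-upward {X} {Z} {e} X⊆Z redundant = ℕP.≤-antisym
    (ℕP.+-cancelʳ-≤ (ρ X) _ _ (begin
      ρ (Z ∪ ⁅ e ⁆) ℕ.+ ρ X        ≤⟨ ℕP.+-mono-≤ (rk-⊆ (∪-least (p⊆p∪q Y) (⊆-trans (q⊆p∪q X ⁅ e ⁆) (q⊆p∪q Z Y))))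
                                                   (rk-⊆ (λ x∈X → x∈p∩q⁺ (X⊆Z x∈X , p⊆p∪q ⁅ e ⁆ x∈X))) ⟩
      ρ (Z ∪ Y) ℕ.+ ρ (Z ∩ Y)      ≤⟨ rk-submod M Z Y ⟩
      ρ Z ℕ.+ ρ Y                  ≡⟨ cong (ρ Z ℕ.+_) redundant ⟩
      ρ Z ℕ.+ ρ X                  ∎))
    (rk-⊆ (p⊆p∪q ⁅ e ⁆))
    where
    open ℕP.≤-Reasoning
    Y = X ∪ ⁅ e ⁆

  private
    insertAll : Subset m → List (Fin m) → Subset m
    insertAll Z []       = Z
    insertAll Z (e ∷ es) = insertAll (Z ∪ ⁅ e ⁆) es

    insertAll-⊇ : ∀ Z es → Z ⊆ insertAll Z es
    insertAll-⊇ Z []       = id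
    insertAll-⊇ Z (e ∷ es) = ⊆-trans (p⊆p∪q ⁅ e ⁆) (insertAll-⊇ (Z ∪ ⁅ e ⁆) es)

    insertAll-∈⁺ : ∀ Z es {x} → x List.∈ es → x ∈ insertAll Z es
    insertAll-∈⁺ Z (e ∷ es) (here refl) = insertAll-⊇ (Z ∪ ⁅ e ⁆) es (q⊆p∪q Z ⁅ e ⁆ (x∈⁅x⁆ e))
    insertAll-∈⁺ Z (e ∷ es) (there x∈es) = insertAll-∈⁺ (Z ∪ ⁅ e ⁆) es x∈es

    insertAll-∈⁻ : ∀ Z es {x} → x ∈ insertAll Z es → x ∈ Z ⊎ x List.∈ es
    insertAll-∈⁻ Z []       x∈ = inj₁ x∈
    insertAll-∈⁻ Z (e ∷ es) x∈ with insertAll-∈⁻ (Z ∪ ⁅ e ⁆) es x∈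
    ... | inj₂ x∈es = inj₂ (there x∈es)
    ... | inj₁ x∈Z∪e with x∈p∪q⁻ Z ⁅ e ⁆ x∈Z∪e
    ...   | inj₁ x∈Z = inj₁ x∈Z
    ...   | inj₂ x∈e = inj₂ (here (x∈⁅y⁆⇒x≡y e x∈e))

    rk-insertAll : ∀ {X} Z es → X ⊆ Z → ρ Z ≡ ρ X → All (Redundant X) es → ρ (insertAll Z es) ≡ ρ X
    rk-insertAll Z []       _   ρZ≡ρX []       = ρZ≡ρX
    rk-insertAll Z (e ∷ es) X⊆Z ρZ≡ρX (r ∷ rs) = rk-insertAll (Z ∪ ⁅ e ⁆) es
      (⊆-trans X⊆Z (p⊆p∪q ⁅ e ⁆)) (trans (redundant-upward X⊆Z r) ρZ≡ρX) rs

    redundant? : ∀ X e → Dec (Redundant X e)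
    redundant? X e = ρ (X ∪ ⁅ e ⁆) ℕP.≟ ρ X

    redundants : Subset m → List (Fin m)
    redundants X = filter (redundant? X) (allFin m)

  cl : Subset m → Subset m
  cl X = insertAll X (redundants X)

  cl-⊇ : ∀ X → X ⊆ cl X
  cl-⊇ X = insertAll-⊇ X (redundants X)

  redundant⇒∈cl : ∀ {X e} → Redundant X e → e ∈ cl X
  redundant⇒∈cl {X} {e} r = insertAll-∈⁺ X (redundants X) (∈-filter⁺ (redundant? X) (∈-allFin e) r)

  rk-cl : ∀ X → ρ (cl X) ≡ ρ X
  rk-cl X = rk-insertAll X (redundants X) id refl (AllP.all-filter (redundant? X) (allFin m))

  cl-flat : ∀ X → Flat ρ (cl X)
  cl-flat X e e∉cl = subst (_< ρ (cl X ∪ ⁅ e ⁆)) (sym (rk-cl X))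
    (ℕP.<-≤-trans (ℕP.≤∧≢⇒< (rk-⊆ (p⊆p∪q ⁅ e ⁆)) (λ eq → e∉cl (redundant⇒∈cl (sym eq))))
                  (rk-⊆ (∪-least (⊆-trans (cl-⊇ X) (p⊆p∪q ⁅ e ⁆)) (q⊆p∪q (cl X) ⁅ e ⁆))))

  cl-least : ∀ {X H} → Flat ρ H → X ⊆ H → cl X ⊆ H
  cl-least {X} {H} flatH X⊆H {x} x∈cl with insertAll-∈⁻ X (redundants X) x∈cl
  ... | inj₁ x∈X = X⊆H x∈X
  ... | inj₂ x∈rs = decidable-stable (x ∈? H) λ x∉H →
    ℕP.<-irrefl (sym (redundant-upward X⊆H (proj₂ (∈-filter⁻ (redundant? X) {xs = allFin m} x∈rs)))) (flatH x x∉H)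

  flat-spanned≡cl : ∀ {S X} → Flat ρ S → X ⊆ S → ρ S ≡ ρ X → S ≡ cl X
  flat-spanned≡cl {S} {X} flatS X⊆S ρS≡ρX = ⊆-antisym S⊆cl (cl-least flatS X⊆S)
    where
    S⊆cl : S ⊆ cl X
    S⊆cl {y} y∈S = redundant⇒∈cl (ℕP.≤-antisym
      (subst (ρ (X ∪ ⁅ y ⁆) ≤_) ρS≡ρX (rk-⊆ (∪-least X⊆S (⁅⁆⊆ y∈S))))
      (rk-⊆ (p⊆p∪q ⁅ y ⁆)))

  rk-∪-⁅⁆-flat : ∀ {G x} → Flat ρ G → x ∉ G → ρ (G ∪ ⁅ x ⁆) ≡ suc (ρ G)
  rk-∪-⁅⁆-flat {G} {x} flatG x∉G = ℕP.≤-antisym (rk-∪-⁅⁆ G x) (flatG x x∉G)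

  covering-flat≡cl : ∀ {G S x} → Flat ρ G → x ∉ G → Flat ρ S → ρ S ≡ suc (ρ G) → G ⊆ S → x ∈ S →
    S ≡ cl (G ∪ ⁅ x ⁆)
  covering-flat≡cl flatG x∉G flatS ρS≡ G⊆S x∈S =
    flat-spanned≡cl flatS (∪-least G⊆S (⁅⁆⊆ x∈S)) (trans ρS≡ (sym (rk-∪-⁅⁆-flat flatG x∉G)))

  FlatChain : List (Subset m) → Set
  FlatChain L = All (Flat ρ) L × AllPairs Comparable L

  comparable-flats-⊆ : ∀ {A B} → Flat ρ B → Comparable A B → ρ A ≤ ρ B → A ⊆ B
  comparable-flats-⊆ _     (inj₁ A⊂B) _     = proj₁ A⊂B
  comparable-flats-⊆ flatB (inj₂ B⊂A) ρA≤ρB = contradiction ρA≤ρB (ℕP.<⇒≱ (flat-rk-< flatB B⊂A))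

  comparable-flats-rk-≢ : ∀ {A B} → Flat ρ A → Flat ρ B → Comparable A B → ρ A ≢ ρ B
  comparable-flats-rk-≢ flatA _     (inj₁ A⊂B) = ℕP.<⇒≢ (flat-rk-< flatA A⊂B)
  comparable-flats-rk-≢ _     flatB (inj₂ B⊂A) = ℕP.<⇒≢ (flat-rk-< flatB B⊂A) ∘ sym

  flatChain-⊆ : ∀ {L A B} → FlatChain L → A List.∈ L → B List.∈ L → ρ A ≤ ρ B → A ⊆ B
  flatChain-⊆ (flats , comparable) A∈L B∈L ρA≤ρB with allPairs-∈ comparable A∈L B∈L
  ... | inj₁ refl         = id
  ... | inj₂ (inj₁ cAB)   = comparable-flats-⊆ (All.lookup flats B∈L) cAB ρA≤ρB
  ... | inj₂ (inj₂ cBA)   = comparable-flats-⊆ (All.lookup flats B∈L) (swap cBA) ρA≤ρB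

  flatChain-rk-unique : ∀ {L} → FlatChain L → Unique (map ρ L)
  flatChain-rk-unique ([] , [])                         = []
  flatChain-rk-unique (flatA ∷ flats , cA ∷ comparable) =
    AllP.map⁺ (All.zipWith (λ (flatB , cAB) → comparable-flats-rk-≢ flatA flatB cAB) (flats , cA))
    ∷ flatChain-rk-unique (flats , comparable)

  truncFlat⇒flat : ∀ {k F} → Flat (truncRk M k) F → Flat ρ F
  truncFlat⇒flat truncFlat e e∉F = ℕP.≰⇒> λ ρF∪e≤ρF → ℕP.<⇒≱ (truncFlat e e∉F) (ℕP.⊓-monoˡ-≤ _ ρF∪e≤ρF)

  flat⇒truncFlat : ∀ {k F} → Flat ρ F → ρ F ≤ k → Flat (truncRk M k) F
  flat⇒truncFlat {k} {F} flatF ρF≤k e e∉F =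
    subst (_< ρ (F ∪ ⁅ e ⁆) ℕ.⊓ suc k) (sym (ℕP.m≤n⇒m⊓n≡m (ℕP.m≤n⇒m≤1+n ρF≤k)))
    (ℕP.⊓-glb (flatF e e∉F) (ℕ.s≤s ρF≤k))

  truncFlat⇒rk≤ : ∀ {k F e} → Flat (truncRk M k) F → e ∉ F → ρ F ≤ k
  truncFlat⇒rk≤ {k} {F} {e} truncFlat e∉F = ℕP.≮⇒≥ λ k<ρF →
    ℕP.<⇒≱ (truncFlat e e∉F)
      (subst (ρ (F ∪ ⁅ e ⁆) ℕ.⊓ suc k ≤_) (sym (ℕP.m≥n⇒m⊓n≡n k<ρF)) (ℕP.m⊓n≤n _ (suc k)))

ΔFan≡1 : ∀ {n} (ρ : Subset (suc n) → ℕ) σ → All (Flat ρ) σ → ΔFan ρ σ ≡ 1ℤ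
ΔFan≡1 ρ σ flats with all? (flat? ρ) σ
... | yes _      = refl
... | no ¬flats = contradiction flats ¬flats

ΔFan≡0 : ∀ {n} (ρ : Subset (suc n) → ℕ) σ → ¬ All (Flat ρ) σ → ΔFan ρ σ ≡ 0ℤ
ΔFan≡0 ρ σ ¬flats with all? (flat? ρ) σ
... | yes flats = contradiction flats ¬flats
... | no _      = refl

ExtendsToFlatCone : ∀ {n} → (Subset (suc n) → ℕ) → List (Subset (suc n)) → Subset (suc n) → Set
ExtendsToFlatCone ρ τ S = IsCone (S ∷ τ) × All (Flat ρ) (S ∷ τ)

coneCoeff-ΔFan : ∀ {n} (ρ : Subset (suc n) → ℕ) τ S →
  (ExtendsToFlatCone ρ τ S × coneCoeff (ΔFan ρ) τ S ≡ 1ℤ) ⊎ (¬ ExtendsToFlatCone ρ τ S × coneCoeff (ΔFan ρ) τ S ≡ 0ℤ)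
coneCoeff-ΔFan ρ τ S with isCone? (S ∷ τ)
... | no ¬cone = inj₂ ((λ (cone , _) → ¬cone cone) , refl)
... | yes cone with all? (flat? ρ) (S ∷ τ)
...   | yes flats = inj₁ ((cone , flats) , refl)
...   | no ¬flats = inj₂ ((λ (_ , flats) → ¬flats flats) , refl)

cupα-vanishing : ∀ {n} (ατ : Vecℤ n) (w : Weight n) τ → (∀ S → coneCoeff w τ S ≡ 0ℤ) → cupα ατ w τ ≡ 0ℤ
cupα-vanishing {n} ατ w τ c≡0 = cong₂ (λ a b → - a + b)
  (sumℤ-zero (allSubsets (suc n)) (λ S → trans (cong (α (eVec S) *_) (c≡0 S)) (ℤP.*-zeroʳ (α (eVec S)))))
  (⟪⟫-zeroʳ ατ λ j → sumℤ-zero (allSubsets (suc n))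
    (λ S → trans (cong (_* eVec S j) (c≡0 S)) (ℤP.*-zeroˡ (eVec S j))))

module IntervalWeight {n} (w : Weight n) (τ : List (Subset (suc n))) {G H : Subset (suc n)} (G⊆H : G ⊆ H)
  (c-01 : ∀ S → coneCoeff w τ S ≡ 0ℤ ⊎ coneCoeff w τ S ≡ 1ℤ)
  (c-between : ∀ {S} → coneCoeff w τ S ≡ 1ℤ → G ⊆ S × S ⊆ H)
  (c-partition : ∀ {x} → x ∈ H → x ∉ G →
    ∃ λ S₀ → coneCoeff w τ S₀ ≡ 1ℤ × x ∈ S₀ × ∀ {S} → coneCoeff w τ S ≡ 1ℤ → x ∈ S → S ≡ S₀)
  where

  private
    c : Subset (suc n) → ℤ
    c = coneCoeff w τ
    As = allSubsets (suc n)

  total : ℤ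
  total = sumℤ (map c As)

  private
    term-∈G : ∀ {x} → x ∈ G → ∀ S → c S * ind x S ≡ c S
    term-∈G {x} x∈G S with c-01 S
    ... | inj₁ cS≡0 = trans (cong (_* ind x S) cS≡0) (sym cS≡0)
    ... | inj₂ cS≡1 = trans (cong (c S *_) (ind-∈ (proj₁ (c-between cS≡1) x∈G))) (ℤP.*-identityʳ (c S))

    term-∉H : ∀ {x} → x ∉ H → ∀ S → c S * ind x S ≡ 0ℤ
    term-∉H {x} x∉H S with c-01 S
    ... | inj₁ cS≡0 = trans (cong (_* ind x S) cS≡0) (ℤP.*-zeroˡ (ind x S))
    ... | inj₂ cS≡1 = trans (cong (c S *_) (ind-∉ (λ x∈S → x∉H (proj₂ (c-between cS≡1) x∈S)))) (ℤP.*-zeroʳ (c S))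

    term-outside : ∀ {x S₀} → (∀ {S} → c S ≡ 1ℤ → x ∈ S → S ≡ S₀) → ∀ S → S ≢ S₀ → c S * ind x S ≡ 0ℤ
    term-outside {x} unique S S≢S₀ with c-01 S
    ... | inj₁ cS≡0 = trans (cong (_* ind x S) cS≡0) (ℤP.*-zeroˡ (ind x S))
    ... | inj₂ cS≡1 = trans (cong (c S *_) (ind-∉ (λ x∈S → S≢S₀ (unique cS≡1 x∈S)))) (ℤP.*-zeroʳ (c S))

  sum-c*ind : ∀ x → sumℤ (map (λ S → c S * ind x S) As) ≡ (total - 1ℤ) * ind x G + ind x H
  sum-c*ind x with x ∈? G | x ∈? H
  ... | yes x∈G | yes _   = trans (sumℤ-cong As (term-∈G x∈G)) (total≡ total)
    where
    total≡ : ∀ t → t ≡ (t - 1ℤ) * 1ℤ + 1ℤ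
    total≡ = solve-∀
  ... | yes x∈G | no x∉H  = contradiction (G⊆H x∈G) x∉H
  ... | no x∉G  | yes x∈H with c-partition x∈H x∉G
  ...   | S₀ , cS₀≡1 , x∈S₀ , unique = begin
    sumℤ (map (λ S → c S * ind x S) As) ≡⟨ sumℤ-allSubsets-single (suc n) _ S₀ (term-outside unique) ⟩
    c S₀ * ind x S₀                     ≡⟨ cong₂ _*_ cS₀≡1 (ind-∈ x∈S₀) ⟩
    1ℤ                                  ≡⟨ one≡ total ⟩
    (total - 1ℤ) * 0ℤ + 1ℤ              ∎
    where
    open ≡-Reasoning
    one≡ : ∀ t → 1ℤ ≡ (t - 1ℤ) * 0ℤ + 1ℤ
    one≡ = solve-∀
  sum-c*ind x | no _ | no x∉H = trans (sumℤ-zero As (term-∉H x∉H)) (zero≡ total)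
    where
    zero≡ : ∀ t → 0ℤ ≡ (t - 1ℤ) * 0ℤ + 0ℤ
    zero≡ = solve-∀

  sum-c*eVec : ∀ j → sumℤ (map (λ S → c S * eVec S j) As) ≡ (total - 1ℤ) * eVec G j + eVec H j
  sum-c*eVec j = begin
      sumℤ (map (λ S → c S * eVec S j) As)
    ≡⟨ sumℤ-cong As (λ S → distrib (c S) (ind (suc j) S) (ind zero S)) ⟩
      sumℤ (map (λ S → c S * ind (suc j) S - c S * ind zero S) As)
    ≡⟨ sumℤ-- As (λ S → c S * ind (suc j) S) (λ S → c S * ind zero S) ⟩
      sumℤ (map (λ S → c S * ind (suc j) S) As) - sumℤ (map (λ S → c S * ind zero S) As)
    ≡⟨ cong₂ _-_ (sum-c*ind (suc j)) (sum-c*ind zero) ⟩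
      ((total - 1ℤ) * ind (suc j) G + ind (suc j) H) - ((total - 1ℤ) * ind zero G + ind zero H)
    ≡⟨ regroup (total - 1ℤ) (ind (suc j) G) (ind (suc j) H) (ind zero G) (ind zero H) ⟩
      (total - 1ℤ) * eVec G j + eVec H j ∎
    where
    open ≡-Reasoning
    distrib : ∀ c a b → c * (a - b) ≡ c * a - c * b
    distrib = solve-∀
    regroup : ∀ t a b a₀ b₀ → (t * a + b) - (t * a₀ + b₀) ≡ t * (a - a₀) + (b - b₀)
    regroup = solve-∀

  cupα≡ : ∀ (ατ : Vecℤ n) {e} → e ∉ G → (∀ {S} → c S ≡ 1ℤ → ∃ λ e → e ∉ S) →
    ⟪ ατ , eVec G ⟫ ≡ α (eVec G) → ⟪ ατ , eVec H ⟫ ≡ α (eVec H) →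
    cupα ατ w τ ≡ ind zero H + α (eVec H)
  cupα≡ ατ e∉G c-proper agreeG agreeH = begin
      - sumℤ (map (λ S → α (eVec S) * c S) As) + ⟪ ατ , (λ j → sumℤ (map (λ S → c S * eVec S j) As)) ⟫
    ≡⟨ cong₂ (λ a b → - a + b) (trans (sumℤ-cong As α-term) (sumℤ-neg As (λ S → c S * ind zero S)))
                               (⟪⟫-cong ατ sum-c*eVec) ⟩
      - - N₀ + ⟪ ατ , (λ j → (total - 1ℤ) * eVec G j + eVec H j) ⟫
    ≡⟨ cong (- - N₀ +_) (⟪⟫-linear ατ (eVec G) (eVec H) (total - 1ℤ)) ⟩
      - - N₀ + ((total - 1ℤ) * ⟪ ατ , eVec G ⟫ + ⟪ ατ , eVec H ⟫)
    ≡⟨ cong₂ (λ a b → - - a + ((total - 1ℤ) * b + ⟪ ατ , eVec H ⟫)) (sum-c*ind zero) (trans agreeG (α-eVec e∉G)) ⟩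
      - - ((total - 1ℤ) * ind zero G + ind zero H) + ((total - 1ℤ) * - ind zero G + ⟪ ατ , eVec H ⟫)
    ≡⟨ cancel (total - 1ℤ) (ind zero G) (ind zero H) ⟪ ατ , eVec H ⟫ ⟩
      ind zero H + ⟪ ατ , eVec H ⟫
    ≡⟨ cong (ind zero H +_) agreeH ⟩
      ind zero H + α (eVec H) ∎
    where
    open ≡-Reasoning
    N₀ = sumℤ (map (λ S → c S * ind zero S) As)
    α-term : ∀ S → α (eVec S) * c S ≡ - (c S * ind zero S)
    α-term S with c-01 S
    ... | inj₁ cS≡0 rewrite cS≡0 = ℤP.*-zeroʳ (α (eVec S))
    ... | inj₂ cS≡1 rewrite cS≡1 = trans (ℤP.*-identityʳ _)
                                     (trans (α-eVec (proj₂ (c-proper cS≡1))) (cong -_ (sym (ℤP.*-identityˡ _))))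
    cancel : ∀ t a b p → - - (t * a + b) + (t * - a + p) ≡ b + p
    cancel = solve-∀

proper⇒⊥⊂ : ∀ {m} {F : Subset m} → Proper F → ⊥ ⊂ F
proper⇒⊥⊂ ((x , x∈F) , _) = ⊥⊆ , x , x∈F , ∉⊥

-- Here rk E = r + 2: r is one less than in the statement, and the truncation is Trunc_r.
module _ (n r : ℕ) (M : Matroid (suc n)) (loopless : ∀ i → rk M ⁅ i ⁆ ≡ 1) (rk-⊤ : rk M ⊤ ≡ suc (suc r))
         (τ : List (Subset (suc n))) (cone : IsCone τ) (len : length τ ≡ r)
         (ατ : Vecℤ n) (agree : AgreesWithαOn ατ τ) where

  private
    ρ : Subset (suc n) → ℕ
    ρ = rk M

  τ̂ : List (Subset (suc n))
  τ̂ = ⊥ ∷ ⊤ ∷ τ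

  ranks : List ℕ
  ranks = map ρ τ̂

  rk-<-bound : ∀ F → ρ F < suc (suc (suc r))
  rk-<-bound F = s≤s (subst (ρ F ≤_) rk-⊤ (rk-⊆ M ⊆⊤))

  module WithFlats (flats : All (Flat ρ) τ) where

    τ̂-chain : FlatChain M τ̂
    τ̂-chain = loopless⇒flat-⊥ M loopless ∷ flat-⊤ M ∷ flats
            , (inj₁ (⊥⊆ , zero , ∈⊤ , ∉⊥) ∷ All.map (inj₁ ∘ proper⇒⊥⊂) (proj₁ cone))
              ∷ All.map (inj₂ ∘ proj₂) (proj₁ cone) ∷ proj₂ cone

    missing : ∃ λ k → k < suc (suc (suc r)) × k List.∉ ranks × (∀ {j} → j < suc (suc (suc r)) → j List.∉ ranks → j ≡ k)
    missing = missing-value (suc (suc r)) ranks (flatChain-rk-unique M τ̂-chain)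
      (AllP.map⁺ (All.tabulate (λ {F} _ → rk-<-bound F))) (trans (length-map ρ τ̂) (cong (λ l → suc (suc l)) len))

    k : ℕ
    k = proj₁ missing

    k<3+r : k < suc (suc (suc r))
    k<3+r = proj₁ (proj₂ missing)

    k∉ranks : k List.∉ ranks
    k∉ranks = proj₁ (proj₂ (proj₂ missing))

    only-k : ∀ {j} → j < suc (suc (suc r)) → j List.∉ ranks → j ≡ k
    only-k = proj₂ (proj₂ (proj₂ missing))

    present : ∀ {j} → j < suc (suc (suc r)) → j ≢ k → ∃ λ F → F List.∈ τ̂ × ρ F ≡ j
    present {j} j<3+r j≢k with j ℕList.∈? ranks
    ... | yes j∈ranks = let F , F∈τ̂ , j≡ρF = ∈-map⁻ ρ j∈ranks in F , F∈τ̂ , sym j≡ρF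
    ... | no j∉ranks  = contradiction (only-k j<3+r j∉ranks) j≢k

    k≢0 : k ≢ 0
    k≢0 k≡0 = k∉ranks (here (trans k≡0 (sym (rk-⊥ M))))

    k<2+r : k < suc (suc r)
    k<2+r = ℕP.≤∧≢⇒< (ℕP.≤-pred k<3+r) λ k≡2+r → k∉ranks (there (here (trans k≡2+r (sym rk-⊤))))

    suc-pred-k : suc (ℕ.pred k) ≡ k
    suc-pred-k = ℕP.suc-pred k ⦃ ℕ.≢-nonZero k≢0 ⦄

    G-spec : ∃ λ G → G List.∈ τ̂ × ρ G ≡ ℕ.pred k
    G-spec = present (ℕP.≤-<-trans ℕP.pred[n]≤n k<3+r)
                     (ℕP.<⇒≢ (subst (ℕ.pred k <_) suc-pred-k (ℕP.n<1+n (ℕ.pred k))))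

    H-spec : ∃ λ H → H List.∈ τ̂ × ρ H ≡ suc k
    H-spec = present (s≤s k<2+r) (ℕP.<⇒≢ (ℕP.n<1+n k) ∘ sym)

    G H : Subset (suc n)
    G = proj₁ G-spec
    H = proj₁ H-spec

    G∈τ̂ : G List.∈ τ̂
    G∈τ̂ = proj₁ (proj₂ G-spec)

    H∈τ̂ : H List.∈ τ̂
    H∈τ̂ = proj₁ (proj₂ H-spec)

    rk-G : suc (ρ G) ≡ k
    rk-G = trans (cong suc (proj₂ (proj₂ G-spec))) suc-pred-k

    rk-H : ρ H ≡ suc k
    rk-H = proj₂ (proj₂ H-spec)

    flat-G : Flat ρ G
    flat-G = All.lookup (proj₁ τ̂-chain) G∈τ̂

    flat-H : Flat ρ H
    flat-H = All.lookup (proj₁ τ̂-chain) H∈τ̂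

    rk-G<k : ρ G < k
    rk-G<k = ℕP.≤-reflexive rk-G

    k<rk-H : k < ρ H
    k<rk-H = ℕP.≤-reflexive (sym rk-H)

    G⊆H : G ⊆ H
    G⊆H = flatChain-⊆ M τ̂-chain G∈τ̂ H∈τ̂ (ℕP.<⇒≤ (ℕP.<-trans rk-G<k k<rk-H))

    Between : Subset (suc n) → Set
    Between S = Flat ρ S × ρ S ≡ k × G ⊆ S × S ⊆ H

    extends⇒between : ∀ {S} → ExtendsToFlatCone ρ τ S → Between S
    extends⇒between {S} ((properS ∷ _ , S~τ ∷ _) , flatS ∷ _) = flatS , rk-S ,
      flatChain-⊆ M S∷τ̂-chain (there G∈τ̂) (here refl) (subst (ρ G ≤_) (sym rk-S) (ℕP.<⇒≤ rk-G<k)) ,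
      flatChain-⊆ M S∷τ̂-chain (here refl) (there H∈τ̂) (subst (_≤ ρ H) (sym rk-S) (ℕP.<⇒≤ k<rk-H))
      where
      S∷τ̂-chain : FlatChain M (S ∷ τ̂)
      S∷τ̂-chain = flatS ∷ proj₁ τ̂-chain
                , (inj₂ (proper⇒⊥⊂ properS) ∷ inj₁ (proj₂ properS) ∷ S~τ) ∷ proj₂ τ̂-chain
      rk-S : ρ S ≡ k
      rk-S with flatChain-rk-unique M S∷τ̂-chain
      ... | ρS∉ranks ∷ _ = only-k (rk-<-bound S) (AllP.All¬⇒¬Any ρS∉ranks)

    between⇒extends : ∀ {S} → Between S → ExtendsToFlatCone ρ τ S
    between⇒extends {S} (flatS , rk-S , G⊆S , S⊆H) =
      ((nonempty , S⊂⊤) ∷ proj₁ cone , All.tabulate S~F ∷ proj₂ cone) , flatS ∷ flats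
      where
      ⊥⊂S : ⊥ ⊂ S
      ⊥⊂S = rk-<⇒⊂ M ⊥⊆ (subst₂ _<_ (sym (rk-⊥ M)) (sym rk-S) (ℕP.n≢0⇒n>0 k≢0))
      nonempty : Nonempty S
      nonempty = let _ , x , x∈S , _ = ⊥⊂S in x , x∈S
      S⊂⊤ : S ⊂ ⊤
      S⊂⊤ = rk-<⇒⊂ M ⊆⊤ (ℕP.<-≤-trans (subst (_< ρ H) (sym rk-S) k<rk-H) (rk-⊆ M ⊆⊤))
      S~F : ∀ {F} → F List.∈ τ → Comparable S F
      S~F {F} F∈τ = by-rank (ℕP.<-cmp (ρ F) k)
        where
        F∈τ̂ : F List.∈ τ̂
        F∈τ̂ = there (there F∈τ)
        by-rank : Tri (ρ F < k) (ρ F ≡ k) (k < ρ F) → Comparable S F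
        by-rank (tri< ρF<k _ _) = inj₂ (rk-<⇒⊂ M (⊆-trans F⊆G G⊆S) (subst (ρ F <_) (sym rk-S) ρF<k))
          where
          F⊆G : F ⊆ G
          F⊆G = flatChain-⊆ M τ̂-chain F∈τ̂ G∈τ̂ (ℕP.≤-pred (subst (ρ F <_) (sym rk-G) ρF<k))
        by-rank (tri≈ _ ρF≡k _) = contradiction (subst (List._∈ ranks) ρF≡k (∈-map⁺ ρ F∈τ̂)) k∉ranks
        by-rank (tri> _ _ k<ρF) = inj₁ (rk-<⇒⊂ M (⊆-trans S⊆H H⊆F) (subst (_< ρ F) (sym rk-S) k<ρF))
          where
          H⊆F : H ⊆ F
          H⊆F = flatChain-⊆ M τ̂-chain H∈τ̂ F∈τ̂ (subst (_≤ ρ F) (sym rk-H) k<ρF)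

    private
      c : Subset (suc n) → ℤ
      c = coneCoeff (ΔFan ρ) τ

    c≡1⇒extends : ∀ {S} → c S ≡ 1ℤ → ExtendsToFlatCone ρ τ S
    c≡1⇒extends {S} cS≡1 with coneCoeff-ΔFan ρ τ S
    ... | inj₁ (extends , _) = extends
    ... | inj₂ (_ , cS≡0)    = contradiction (trans (sym cS≡1) cS≡0) λ ()

    extends⇒c≡1 : ∀ {S} → ExtendsToFlatCone ρ τ S → c S ≡ 1ℤ
    extends⇒c≡1 {S} extends with coneCoeff-ΔFan ρ τ S
    ... | inj₁ (_ , cS≡1)     = cS≡1
    ... | inj₂ (¬extends , _) = contradiction extends ¬extends

    c-01 : ∀ S → c S ≡ 0ℤ ⊎ c S ≡ 1ℤ
    c-01 S with coneCoeff-ΔFan ρ τ S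
    ... | inj₁ (_ , cS≡1) = inj₂ cS≡1
    ... | inj₂ (_ , cS≡0) = inj₁ cS≡0

    c-between : ∀ {S} → c S ≡ 1ℤ → G ⊆ S × S ⊆ H
    c-between cS≡1 = let _ , _ , G⊆S , S⊆H = extends⇒between (c≡1⇒extends cS≡1) in G⊆S , S⊆H

    -- x lies in exactly one flat of rank k between G and H, namely cl (G ∪ {x}).
    c-partition : ∀ {x} → x ∈ H → x ∉ G →
      ∃ λ S₀ → c S₀ ≡ 1ℤ × x ∈ S₀ × ∀ {S} → c S ≡ 1ℤ → x ∈ S → S ≡ S₀
    c-partition {x} x∈H x∉G =
      S₀ , extends⇒c≡1 (between⇒extends S₀-between) , G∪x⊆S₀ (q⊆p∪q G ⁅ x ⁆ (x∈⁅x⁆ x)) , unique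
      where
      S₀ = cl M (G ∪ ⁅ x ⁆)
      G∪x⊆S₀ : G ∪ ⁅ x ⁆ ⊆ S₀
      G∪x⊆S₀ = cl-⊇ M (G ∪ ⁅ x ⁆)
      S₀-between : Between S₀
      S₀-between = cl-flat M _ , trans (rk-cl M _) (trans (rk-∪-⁅⁆-flat M flat-G x∉G) rk-G) ,
                   ⊆-trans (p⊆p∪q ⁅ x ⁆) G∪x⊆S₀ , cl-least M flat-H (∪-least G⊆H (⁅⁆⊆ x∈H))
      unique : ∀ {S} → c S ≡ 1ℤ → x ∈ S → S ≡ S₀
      unique cS≡1 x∈S = let flatS , rk-S , G⊆S , _ = extends⇒between (c≡1⇒extends cS≡1) in
        covering-flat≡cl M flat-G x∉G flatS (trans rk-S (sym rk-G)) G⊆S x∈S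

    c-proper : ∀ {S} → c S ≡ 1ℤ → ∃ λ e → e ∉ S
    c-proper cS≡1 with c≡1⇒extends cS≡1
    ... | ((_ , _ , e , _ , e∉S) ∷ _ , _) , _ = e , e∉S

    agree-τ̂ : AgreesWithαOn ατ τ̂
    agree-τ̂ = trans (⟪⟫-zeroʳ ατ eVec-⊥) (sym (α-eVec-⊥ {n}))
            ∷ trans (⟪⟫-zeroʳ ατ eVec-⊤) (sym (α-eVec-⊤ {n}))
            ∷ agree

    G⊂⊤ : G ⊂ ⊤
    G⊂⊤ = rk-<⇒⊂ M ⊆⊤ (ℕP.<-≤-trans (ℕP.<-trans rk-G<k k<rk-H) (rk-⊆ M ⊆⊤))

    cupα-value : cupα ατ (ΔFan ρ) τ ≡ ind zero H + α (eVec H)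
    cupα-value = IntervalWeight.cupα≡ (ΔFan ρ) τ G⊆H c-01 c-between c-partition ατ
      (proj₂ (proj₂ (proj₂ G⊂⊤))) c-proper (All.lookup agree-τ̂ G∈τ̂) (All.lookup agree-τ̂ H∈τ̂)

    rk-τ-< : ∀ {F} → F List.∈ τ → ρ F < suc (suc r)
    rk-τ-< {F} F∈τ = subst (ρ F <_) rk-⊤ (flat-rk-< M (All.lookup flats F∈τ) (proj₂ (All.lookup (proj₁ cone) F∈τ)))

    missing-top : k ≡ suc r → cupα ατ (ΔFan ρ) τ ≡ ΔFan (truncRk M r) τ
    missing-top k≡1+r = begin
      cupα ατ (ΔFan ρ) τ        ≡⟨ cupα-value ⟩
      ind zero H + α (eVec H)   ≡⟨ cong (λ X → ind zero X + α (eVec X)) H≡⊤ ⟩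
      ind zero E + α (eVec E)   ≡⟨ cong₂ _+_ (ind-∈ {x = zero} {S = E} ∈⊤) (α-eVec-⊤ {n}) ⟩
      1ℤ                        ≡⟨ sym (ΔFan≡1 (truncRk M r) τ (All.tabulate truncFlat)) ⟩
      ΔFan (truncRk M r) τ      ∎
      where
      open ≡-Reasoning
      E = ⊤ {suc n}
      H≡⊤ : H ≡ ⊤
      H≡⊤ = flat-full-rank M flat-H (trans rk-H (trans (cong suc k≡1+r) (sym rk-⊤)))
      truncFlat : ∀ {F} → F List.∈ τ → Flat (truncRk M r) F
      truncFlat {F} F∈τ =
        flat⇒truncFlat M (All.lookup flats F∈τ) (ℕP.≤-pred (ℕP.≤∧≢⇒< (ℕP.≤-pred (rk-τ-< F∈τ)) ρF≢1+r))
        where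
        ρF≢1+r : ρ F ≢ suc r
        ρF≢1+r ρF≡1+r = k∉ranks (subst (List._∈ ranks) (trans ρF≡1+r (sym k≡1+r)) (∈-map⁺ ρ (there (there F∈τ))))

    missing-below-top : k ≢ suc r → cupα ατ (ΔFan ρ) τ ≡ ΔFan (truncRk M r) τ
    missing-below-top k≢1+r = begin
      cupα ατ (ΔFan ρ) τ        ≡⟨ cupα-value ⟩
      ind zero H + α (eVec H)   ≡⟨ cong (ind zero H +_) (α-eVec (proj₂ (proj₂ (proj₂ H⊂⊤)))) ⟩
      ind zero H + - ind zero H ≡⟨ ℤP.+-inverseʳ (ind zero H) ⟩
      0ℤ                        ≡⟨ sym (ΔFan≡0 (truncRk M r) τ not-truncFlats) ⟩
      ΔFan (truncRk M r) τ      ∎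
      where
      open ≡-Reasoning
      H⊂⊤ : H ⊂ ⊤
      H⊂⊤ = rk-<⇒⊂ M ⊆⊤ (subst₂ _<_ (sym rk-H) (sym rk-⊤) (s≤s (ℕP.≤∧≢⇒< (ℕP.≤-pred k<2+r) k≢1+r)))
      rank-1+r : ∃ λ F → F List.∈ τ̂ × ρ F ≡ suc r
      rank-1+r = present (ℕP.m<n⇒m<1+n (ℕP.n<1+n (suc r))) (k≢1+r ∘ sym)
      in-τ : ∀ {F} → F List.∈ τ̂ → ρ F ≡ suc r → F List.∈ τ
      in-τ (here refl)          ρ⊥≡1+r = contradiction (trans (sym (rk-⊥ M)) ρ⊥≡1+r) λ ()
      in-τ (there (here refl))  ρ⊤≡1+r = contradiction (trans (sym rk-⊤) ρ⊤≡1+r) (ℕP.<⇒≢ (ℕP.n<1+n (suc r)) ∘ sym)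
      in-τ (there (there F∈τ)) _      = F∈τ
      not-truncFlats : ¬ All (Flat (truncRk M r)) τ
      not-truncFlats truncFlats with rank-1+r
      ... | F , F∈τ̂ , ρF≡1+r with All.lookup (proj₁ cone) (in-τ F∈τ̂ ρF≡1+r)
      ...   | _ , _ , e , _ , e∉F =
        ℕP.<-irrefl refl (subst (_≤ r) ρF≡1+r (truncFlat⇒rk≤ M (All.lookup truncFlats (in-τ F∈τ̂ ρF≡1+r)) e∉F))

    result : cupα ατ (ΔFan ρ) τ ≡ ΔFan (truncRk M r) τ
    result with k ℕP.≟ suc r
    ... | yes k≡1+r = missing-top k≡1+r
    ... | no k≢1+r  = missing-below-top k≢1+r

  nonflat : ¬ All (Flat ρ) τ → cupα ατ (ΔFan ρ) τ ≡ ΔFan (truncRk M r) τ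
  nonflat ¬flats = trans (cupα-vanishing ατ (ΔFan ρ) τ c≡0)
                         (sym (ΔFan≡0 (truncRk M r) τ (¬flats ∘ All.map (truncFlat⇒flat M))))
    where
    c≡0 : ∀ S → coneCoeff (ΔFan ρ) τ S ≡ 0ℤ
    c≡0 S with coneCoeff-ΔFan ρ τ S
    ... | inj₁ ((_ , _ ∷ flats) , _) = contradiction flats ¬flats
    ... | inj₂ (_ , cS≡0)            = cS≡0

  cupα-ΔFan : cupα ατ (ΔFan ρ) τ ≡ ΔFan (truncRk M r) τ
  cupα-ΔFan = by-flatness (all? (flat? ρ) τ)
    where
    by-flatness : Dec (All (Flat ρ) τ) → cupα ατ (ΔFan ρ) τ ≡ ΔFan (truncRk M r) τ
    by-flatness (yes flats) = WithFlats.result flats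
    by-flatness (no ¬flats) = nonflat ¬flats

lemma5p1 : (n r : ℕ) (M : Matroid (suc n)) → Simple M → 1 ≤ r → rk M ⊤ ≡ suc r →
    (τ : List (Subset (suc n))) → IsCone τ → length τ ≡ r ∸ 1 →
    (ατ : Vecℤ n) → AgreesWithαOn ατ τ →
    cupα ατ (ΔFan (rk M)) τ ≡ ΔFan (truncRk M (r ∸ 1)) τ
lemma5p1 n zero    M _             ()
lemma5p1 n (suc r) M (loopless , _) _ rk-⊤ τ cone len ατ agree = cupα-ΔFan n r M loopless rk-⊤ τ cone len ατ agree
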